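{- For $k\ge 2$, let $G$ be a complete $k$-partite graph of order $n\ge 3$. Then $\mathrm{edim}_f(G)=\frac{n-1}{2}$ if $G=K_{1,n-1}$, and $\mathrm{edim}_f(G)=\frac{n}{2}$ otherwise.
   Context: All graphs are finite, simple, undirected; $d(u,w)$ is the length of a shortest $u$–$w$ path. For a vertex $v$ and an edge $e=xy$, $d(e,v)=\min\{d(x,v),d(y,v)\}$; for distinct edges $e_1,e_2$, $R_e\{e_1,e_2\}=\{v: d(v,e_1)\neq d(v,e_2)\}$. For $g:V\to\mathbb{R}$ and $U\subseteq V$, $g(U)=\sum_{s\in U}g(s)$. A function $g:V(G)\to[0,1]$ is an edge resolving function of $G$ if $g(R_e\{e_1,e_2\})\ge1$ for all distinct edges $e_1,e_2$, and $\mathrm{edim}_f(G)=\min\{g(V(G)): g\text{ an edge resolving function of }G\}$.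
   Formalization: Edge resolving functions take rational values in [0,1] rather than real values, both in the witness and in the minimality bound for $\mathrm{edim}_f(G)$. -}

module Defs where

open import Data.Nat as ℕ using (ℕ; zero; suc; _∸_)
open import Data.Fin as Fin using (Fin; toℕ)
open import Data.Bool using (Bool; true; false; _∧_; _∨_; not; if_then_else_)
open import Data.List using (List; allFin; foldr; map)
open import Data.Bool.ListAction using (any)
open import Data.Integer using (+_)
open import Data.Rational as ℚ using (ℚ; 0ℚ; 1ℚ)
open import Data.Product using (Σ; ∃; _×_; _,_)
open import Data.Sum using (_⊎_)
open import Relation.Nullary using (¬_)
open import Relation.Nullary.Decidable using (⌊_⌋)
open import Relation.Binary.PropositionalEquality using (_≡_; _≢_)

Adj : ℕ → Set
Adj n = Fin n → Fin n → Bool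

module _ {n : ℕ} (adj : Adj n) where

  reach : ℕ → Fin n → Fin n → Bool
  reach zero    u v = ⌊ u Fin.≟ v ⌋
  reach (suc m) u v = reach m u v ∨ any (λ w → reach m u w ∧ adj w v) (allFin n)

  private
    search : ℕ → Fin n → Fin n → ℕ → ℕ
    search zero     u v m = m
    search (suc f)  u v m = if reach m u v then m else search f u v (suc m)

  -- shortest-path distance d(u,v) (correct for connected graphs; a shortest
  -- path has length < n, so fuel n suffices)
  dist : Fin n → Fin n → ℕ
  dist u v = search n u v 0

  edgeDist : Fin n → Fin n → Fin n → ℕ
  edgeDist x y v = dist x v ℕ.⊓ dist y v

  inR : Fin n → Fin n → Fin n → Fin n → Fin n → Bool
  inR x₁ y₁ x₂ y₂ v = not ⌊ edgeDist x₁ y₁ v ℕ.≟ edgeDist x₂ y₂ v ⌋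

  gSum : (Fin n → ℚ) → (Fin n → Bool) → ℚ
  gSum g U = foldr ℚ._+_ 0ℚ (map (λ s → if U s then g s else 0ℚ) (allFin n))

  total : (Fin n → ℚ) → ℚ
  total g = gSum g (λ _ → true)

  -- An edge is represented canonically as (x , y) with adj x y and x < y,
  -- so distinct edges are distinct ordered pairs.
  IsEdge : Fin n → Fin n → Set
  IsEdge x y = (adj x y ≡ true) × (toℕ x ℕ.< toℕ y)

  IsEdgeResolving : (Fin n → ℚ) → Set
  IsEdgeResolving g =
    (∀ v → (0ℚ ℚ.≤ g v) × (g v ℚ.≤ 1ℚ)) ×
    (∀ x₁ y₁ x₂ y₂ → IsEdge x₁ y₁ → IsEdge x₂ y₂ → ¬ ((x₁ ≡ x₂) × (y₁ ≡ y₂)) →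
       1ℚ ℚ.≤ gSum g (inR x₁ y₁ x₂ y₂))

  EdimF≡ : ℚ → Set
  EdimF≡ q = (Σ (Fin n → ℚ) λ g → IsEdgeResolving g × (total g ≡ q)) ×
             (∀ g → IsEdgeResolving g → q ℚ.≤ total g)

  IsStar : Set
  IsStar = ∃ λ c → (∀ u v → adj u v ≡ true → (u ≡ c ⊎ v ≡ c) × (u ≢ v))
                  × (∀ u v → u ≢ v → (u ≡ c ⊎ v ≡ c) → adj u v ≡ true)

multipartite : {n k : ℕ} → (Fin n → Fin k) → Adj n
multipartite p u v = not ⌊ p u Fin.≟ p v ⌋

AllPartsNonempty : {n k : ℕ} → (Fin n → Fin k) → Set
AllPartsNonempty {n} {k} p = ∀ (i : Fin k) → ∃ λ v → p v ≡ i

-- In a complete multipartite graph with nonempty parts every vertex outside an edge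
-- is adjacent to one of its endpoints, so d(e,v) is 0 on the endpoints of e and 1
-- elsewhere: R_e{e₁,e₂} is the symmetric difference of the endpoint sets of e₁ and e₂.
-- It always has two vertices, so the constant ½ resolves; for a star the centre lies
-- on every edge and can get weight 0.  Conversely, for edges xy and xz the set
-- R_e{xy,xz} is {y,z}, so g y + g z ≥ 1 whenever y and z have a common neighbour.
-- On a set where all pairs have weight ≥ 1 at most one vertex lies below ½, and its
-- deficit is paid by any other vertex, so the set carries at least half its size.
-- Such sets are: all vertices (k ≥ 3), each of the two parts (k = 2; both have two
-- vertices unless G is a star), and the leaves of a star.

module Submission where

open import Defs

open import Data.Bool as Bool using (Bool; true; false; not; _∧_; _∨_; _xor_; if_then_else_)
open import Data.Bool.ListAction using (any)
open import Data.Bool.Properties using (T-≡; if-cong; ∨-comm; ∨-zeroʳ)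
open import Data.Empty using (⊥-elim)
open import Data.Fin as Fin using (Fin; zero; suc; toℕ; punchIn; punchOut)
import Data.Fin.Properties as FinP
open import Data.Fin.Properties using (any?; toℕ-injective; punchInᵢ≢i; punchIn-injective; punchIn-punchOut)
open import Data.Integer as ℤ using (+_)
open import Data.List using (List; []; _∷_; allFin; foldr; map; tabulate)
open import Data.List.Membership.Propositional.Properties using (∈-allFin)
open import Data.List.Properties using (map-tabulate)
import Data.List.Relation.Unary.Any as Any
open import Data.List.Relation.Unary.Any.Properties using (any⁺)
open import Data.Nat as ℕ using (ℕ; zero; suc; _≤_; _∸_; z≤n; s≤s)
import Data.Nat.Properties as ℕP
open import Data.Product using (Σ; ∃; ∃₂; _×_; _,_; proj₁)
open import Data.Rational as ℚ using (ℚ; 0ℚ; 1ℚ; ½; _+_; _-_; -_; _/_; toℚᵘ)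
import Data.Rational.Properties as ℚP
import Data.Rational.Solver as QS
import Data.Rational.Unnormalised as ℚᵘ
import Data.Rational.Unnormalised.Properties as ℚᵘP
open import Data.Sum as Sum using (_⊎_; inj₁; inj₂)
open import Function using (Equivalence; id; _∘_)
open import Relation.Binary.Definitions using (tri<; tri≈; tri>)
open import Relation.Binary.PropositionalEquality
open import Relation.Nullary using (¬_; yes; no; ¬?; contradiction)
open import Relation.Nullary.Decidable
  using (⌊_⌋; dec-true; dec-false; isYes≗does; toSum; _×-dec_; toWitness; toWitnessFalse; decidable-stable)

open import Algebra.Properties.CommutativeMonoid.Sum ℚP.+-0-commutativeMonoid
  using (sum; ∑-distrib-+; sum-remove; sum-cong-≗; sum-replicate-zero)

≟-equal : ∀ {n} {v a : Fin n} → v ≡ a → ⌊ v Fin.≟ a ⌋ ≡ true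
≟-equal {v = v} {a} v≡a = trans (isYes≗does (v Fin.≟ a)) (dec-true (v Fin.≟ a) v≡a)

≟-self : ∀ {n} (a : Fin n) → ⌊ a Fin.≟ a ⌋ ≡ true
≟-self a = ≟-equal refl

≟-distinct : ∀ {n} {v a : Fin n} → v ≢ a → ⌊ v Fin.≟ a ⌋ ≡ false
≟-distinct {v = v} {a} v≢a = trans (isYes≗does (v Fin.≟ a)) (dec-false (v Fin.≟ a) v≢a)

≟-true⁻ : ∀ {n} {v a : Fin n} → ⌊ v Fin.≟ a ⌋ ≡ true → v ≡ a
≟-true⁻ e = toWitness (Equivalence.from T-≡ e)

≟-false⁻ : ∀ {n} {v a : Fin n} → not ⌊ v Fin.≟ a ⌋ ≡ true → v ≢ a
≟-false⁻ e = toWitnessFalse (Equivalence.from T-≡ e)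

another : ∀ {k} (i : Fin (suc (suc k))) → ∃ λ j → j ≢ i
another i = punchIn i zero , punchInᵢ≢i i zero

avoiding-two : ∀ {k} (i j : Fin (suc (suc (suc k)))) → ∃ λ t → t ≢ i × t ≢ j
avoiding-two i j with toSum (i Fin.≟ j)
... | inj₁ refl = let t , t≢i = another i in t , t≢i , t≢i
... | inj₂ i≢j = punchIn i (punchIn j′ zero) , punchInᵢ≢i i _ , avoids-j
  where
  j′ = punchOut i≢j
  avoids-j : punchIn i (punchIn j′ zero) ≢ j
  avoids-j e = punchInᵢ≢i j′ zero (punchIn-injective i _ _ (trans e (sym (punchIn-punchOut i≢j))))

two-others : ∀ {m} (c : Fin (suc (suc (suc m)))) → ∃₂ λ a b → a ≢ b × a ≢ c × b ≢ c
two-others c = punchIn c zero , punchIn c (suc zero) , (λ e → contradiction (punchIn-injective c _ _ e) λ ()) ,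
               punchInᵢ≢i c zero , punchInᵢ≢i c (suc zero)

Fin2-≢⇒one-≡ : ∀ {a b : Fin 2} i → a ≢ b → a ≡ i ⊎ b ≡ i
Fin2-≢⇒one-≡ {zero}     {zero}     _          a≢b = contradiction refl a≢b
Fin2-≢⇒one-≡ {zero}     {suc zero} zero       _   = inj₁ refl
Fin2-≢⇒one-≡ {zero}     {suc zero} (suc zero) _   = inj₂ refl
Fin2-≢⇒one-≡ {suc zero} {zero}     zero       _   = inj₂ refl
Fin2-≢⇒one-≡ {suc zero} {zero}     (suc zero) _   = inj₁ refl
Fin2-≢⇒one-≡ {suc zero} {suc zero} _          a≢b = contradiction refl a≢b

-- Endpoints of edges

endpoint : ∀ {n} → Fin n → Fin n → Fin n → Bool
endpoint x y v = ⌊ v Fin.≟ x ⌋ ∨ ⌊ v Fin.≟ y ⌋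

endpoint-left : ∀ {n} (x y : Fin n) → endpoint x y x ≡ true
endpoint-left x y = cong (_∨ ⌊ x Fin.≟ y ⌋) (≟-self x)

endpoint-right : ∀ {n} (x y : Fin n) → endpoint x y y ≡ true
endpoint-right x y = trans (cong (⌊ y Fin.≟ x ⌋ ∨_) (≟-self y)) (∨-zeroʳ _)

endpoint-true : ∀ {n} (x y : Fin n) {v} → v ≡ x ⊎ v ≡ y → endpoint x y v ≡ true
endpoint-true x y (inj₁ refl) = endpoint-left x y
endpoint-true x y (inj₂ refl) = endpoint-right x y

endpoint-false : ∀ {n} {x y v : Fin n} → v ≢ x → v ≢ y → endpoint x y v ≡ false
endpoint-false v≢x v≢y = cong₂ _∨_ (≟-distinct v≢x) (≟-distinct v≢y)

endpoint⁻ : ∀ {n} {x y v : Fin n} → endpoint x y v ≡ true → v ≡ x ⊎ v ≡ y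
endpoint⁻ {x = x} {y} {v} e with toSum (v Fin.≟ x) | toSum (v Fin.≟ y)
... | inj₁ v≡x | _        = inj₁ v≡x
... | inj₂ _   | inj₁ v≡y = inj₂ v≡y
... | inj₂ v≢x | inj₂ v≢y = contradiction (trans (sym e) (endpoint-false v≢x v≢y)) λ ()

endpoint-sym : ∀ {n} (x y v : Fin n) → endpoint x y v ≡ endpoint y x v
endpoint-sym x y v = ∨-comm ⌊ v Fin.≟ x ⌋ ⌊ v Fin.≟ y ⌋

endpoint-xor-sharing : ∀ {n} {x y z : Fin n} → x ≢ y → x ≢ z → y ≢ z →
  ∀ v → endpoint x y v xor endpoint x z v ≡ endpoint y z v
endpoint-xor-sharing {x = x} {y} {z} x≢y x≢z y≢z v
  with toSum (v Fin.≟ x) | toSum (v Fin.≟ y) | toSum (v Fin.≟ z)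
... | inj₁ refl | _ | _ =
  trans (cong₂ _xor_ (endpoint-left x y) (endpoint-left x z)) (sym (endpoint-false x≢y x≢z))
... | inj₂ v≢x | inj₁ refl | _ =
  trans (cong₂ _xor_ (endpoint-right x y) (endpoint-false v≢x y≢z)) (sym (endpoint-left y z))
... | inj₂ v≢x | inj₂ v≢y | inj₁ refl =
  trans (cong₂ _xor_ (endpoint-false v≢x v≢y) (endpoint-right x z)) (sym (endpoint-right y z))
... | inj₂ v≢x | inj₂ v≢y | inj₂ v≢z =
  trans (cong₂ _xor_ (endpoint-false v≢x v≢y) (endpoint-false v≢x v≢z)) (sym (endpoint-false v≢y v≢z))

unshared-endpoint : ∀ {n} {x₁ y₁ x₂ y₂ : Fin n} → toℕ x₁ ℕ.< toℕ y₁ → toℕ x₂ ℕ.< toℕ y₂ →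
  ¬ (x₁ ≡ x₂ × y₁ ≡ y₂) → ∃ λ a → endpoint x₁ y₁ a ≡ true × endpoint x₂ y₂ a ≡ false
unshared-endpoint {x₁ = x₁} {y₁} {x₂} {y₂} x₁<y₁ x₂<y₂ distinct
  with toSum (x₁ Fin.≟ x₂) | toSum (x₁ Fin.≟ y₂)
... | inj₂ x₁≢x₂ | inj₂ x₁≢y₂ = x₁ , endpoint-left x₁ y₁ , endpoint-false x₁≢x₂ x₁≢y₂
... | inj₁ refl | _ with toSum (y₁ Fin.≟ x₂) | toSum (y₁ Fin.≟ y₂)
...   | inj₂ y₁≢x₂ | inj₂ y₁≢y₂ = y₁ , endpoint-right x₁ y₁ , endpoint-false y₁≢x₂ y₁≢y₂
...   | inj₁ refl | _ = ⊥-elim (FinP.<⇒≢ x₁<y₁ refl)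
...   | inj₂ _ | inj₁ refl = ⊥-elim (distinct (refl , refl))
unshared-endpoint {x₁ = x₁} {y₁} {x₂} {y₂} x₁<y₁ x₂<y₂ distinct
  | inj₂ x₁≢x₂ | inj₁ refl with toSum (y₁ Fin.≟ x₂) | toSum (y₁ Fin.≟ y₂)
...   | inj₂ y₁≢x₂ | inj₂ y₁≢y₂ = y₁ , endpoint-right x₁ y₁ , endpoint-false y₁≢x₂ y₁≢y₂
...   | inj₁ refl | _ = ⊥-elim (ℕP.<-asym x₁<y₁ x₂<y₂)
...   | inj₂ _ | inj₁ refl = ⊥-elim (FinP.<⇒≢ x₁<y₁ refl)

symmetricDifference-two : ∀ {n} {x₁ y₁ x₂ y₂ : Fin n} → toℕ x₁ ℕ.< toℕ y₁ → toℕ x₂ ℕ.< toℕ y₂ →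
  ¬ (x₁ ≡ x₂ × y₁ ≡ y₂) → ∃₂ λ a b → a ≢ b ×
    endpoint x₁ y₁ a xor endpoint x₂ y₂ a ≡ true × endpoint x₁ y₁ b xor endpoint x₂ y₂ b ≡ true
symmetricDifference-two x₁<y₁ x₂<y₂ distinct
  with unshared-endpoint x₁<y₁ x₂<y₂ distinct
     | unshared-endpoint x₂<y₂ x₁<y₁ (λ { (refl , refl) → distinct (refl , refl) })
... | a , in₁ , out₂ | b , in₂ , out₁ =
  a , b , (λ { refl → contradiction (trans (sym in₁) out₁) λ () }) ,
  cong₂ _xor_ in₁ out₂ , cong₂ _xor_ out₁ in₂

-- Finite sums of rationals

0≤½ : 0ℚ ℚ.≤ ½
0≤½ = ℚ.*≤* (ℤ.+≤+ z≤n)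

½≤1 : ½ ℚ.≤ 1ℚ
½≤1 = ℚ.*≤* (ℤ.+≤+ (s≤s z≤n))

restrict : ∀ {n} → (Fin n → Bool) → (Fin n → ℚ) → Fin n → ℚ
restrict U f v = if U v then f v else 0ℚ

foldr-tabulate : ∀ {n} (f : Fin n → ℚ) → foldr _+_ 0ℚ (tabulate f) ≡ sum f
foldr-tabulate {ℕ.zero} f = refl
foldr-tabulate {suc n} f = cong (λ s → f zero + s) (foldr-tabulate (f ∘ suc))

foldr-map-allFin : ∀ {n} (f : Fin n → ℚ) → foldr _+_ 0ℚ (map f (allFin n)) ≡ sum f
foldr-map-allFin {n} f = trans (cong (foldr _+_ 0ℚ) (map-tabulate id f)) (foldr-tabulate f)

sum-mono-≤ : ∀ {n} {f g : Fin n → ℚ} → (∀ i → f i ℚ.≤ g i) → sum f ℚ.≤ sum g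
sum-mono-≤ {ℕ.zero} f≤g = ℚP.≤-refl
sum-mono-≤ {suc n} f≤g = ℚP.+-mono-≤ (f≤g zero) (sum-mono-≤ (f≤g ∘ suc))

sum-constExcept : ∀ {n} (a : Fin (suc n)) (f : Fin (suc n) → ℚ) {q} →
  (∀ v → v ≢ a → f v ≡ q) → sum f ≡ f a + sum {n} (λ _ → q)
sum-constExcept a f f≡q = trans (sum-remove {i = a} f) (cong (λ s → f a + s) (sum-cong-≗ (λ j → f≡q _ (punchInᵢ≢i a j))))

-- (+ n) / 2 is normalised by a gcd, so the identity is checked on unnormalised representatives.
½+n/2≡[1+n]/2 : ∀ n → ½ + (+ n) / 2 ≡ (+ suc n) / 2
½+n/2≡[1+n]/2 n = ℚP.toℚᵘ-injective (begin
    toℚᵘ (½ + (+ n) / 2)                           ≈⟨ ℚP.toℚᵘ-homo-+ ½ ((+ n) / 2) ⟩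
    toℚᵘ ½ ℚᵘ.+ toℚᵘ ((+ n) / 2)                  ≈⟨ ℚᵘP.+-cong (ℚP.toℚᵘ-fromℚᵘ (ℚᵘ.mkℚᵘ (+ 1) 1)) (ℚP.toℚᵘ-fromℚᵘ (ℚᵘ.mkℚᵘ (+ n) 1)) ⟩
    ℚᵘ.mkℚᵘ (+ 1) 1 ℚᵘ.+ ℚᵘ.mkℚᵘ (+ n) 1           ≈⟨ ℚᵘ.*≡* (solve 1 (λ x → (con (+ 1) :* con (+ 2) :+ x :* con (+ 2)) :* con (+ 2) := (con (+ 1) :+ x) :* con (+ 4)) refl (+ n)) ⟩
    ℚᵘ.mkℚᵘ (+ suc n) 1                         ≈⟨ ℚᵘP.≃-sym (ℚP.toℚᵘ-fromℚᵘ _) ⟩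
    toℚᵘ ((+ suc n) / 2)                        ∎)
  where
  open ℚᵘP.≃-Reasoning
  open import Data.Integer.Solver using (module +-*-Solver)
  open +-*-Solver

sum-const-½ : ∀ n → sum {n} (λ _ → ½) ≡ (+ n) / 2
sum-const-½ ℕ.zero = refl
sum-const-½ (suc n) = trans (cong (λ s → ½ + s) (sum-const-½ n)) (½+n/2≡[1+n]/2 n)

restrict-in : ∀ {n} (U : Fin n → Bool) (f : Fin n → ℚ) {v} → U v ≡ true → restrict U f v ≡ f v
restrict-in U f Uv = cong (λ b → if b then f _ else 0ℚ) Uv

restrict-out : ∀ {n} (U : Fin n → Bool) (f : Fin n → ℚ) {v} → U v ≡ false → restrict U f v ≡ 0ℚ
restrict-out U f Uv = cong (λ b → if b then f _ else 0ℚ) Uv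

pointMass : ∀ {n} → Fin n → ℚ → Fin n → ℚ
pointMass a q = restrict (λ v → ⌊ v Fin.≟ a ⌋) (λ _ → q)

pointMass-self : ∀ {n} (a : Fin n) q → pointMass a q a ≡ q
pointMass-self a q = restrict-in (λ v → ⌊ v Fin.≟ a ⌋) (λ _ → q) (≟-self a)

pointMass-other : ∀ {n} {a v : Fin n} q → v ≢ a → pointMass a q v ≡ 0ℚ
pointMass-other {a = a} q v≢a = restrict-out (λ v → ⌊ v Fin.≟ a ⌋) (λ _ → q) (≟-distinct v≢a)

sum-pointMass : ∀ {n} (a : Fin n) q → sum (pointMass a q) ≡ q
sum-pointMass {suc n} a q = begin
  sum (pointMass a q)                  ≡⟨ sum-constExcept a (pointMass a q) (λ v → pointMass-other q) ⟩
  pointMass a q a + sum {n} (λ _ → 0ℚ) ≡⟨ cong₂ _+_ (pointMass-self a q) (sum-replicate-zero n) ⟩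
  q + 0ℚ                               ≡⟨ ℚP.+-identityʳ q ⟩
  q                                    ∎
  where open ≡-Reasoning

restrict-cong : ∀ {n} {U V : Fin n → Bool} (f : Fin n → ℚ) → (∀ v → U v ≡ V v) → ∀ v → restrict U f v ≡ restrict V f v
restrict-cong f U≗V v = cong (λ b → if b then f v else 0ℚ) (U≗V v)

restrict-mono-≤ : ∀ {n} (U : Fin n → Bool) {f g : Fin n → ℚ} {v} →
  (U v ≡ true → f v ℚ.≤ g v) → restrict U f v ℚ.≤ restrict U g v
restrict-mono-≤ U {f} {g} {v} f≤g = on (U v) refl
  where
  on : ∀ b → U v ≡ b → (if b then f v else 0ℚ) ℚ.≤ (if b then g v else 0ℚ)
  on true Uv = f≤g Uv
  on false _ = ℚP.≤-refl

gSum≡sum-restrict : ∀ {n} (adj : Adj n) (g : Fin n → ℚ) U → gSum adj g U ≡ sum (restrict U g)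
gSum≡sum-restrict adj g U = foldr-map-allFin (restrict U g)

total≡sum : ∀ {n} (adj : Adj n) (g : Fin n → ℚ) → total adj g ≡ sum g
total≡sum adj g = gSum≡sum-restrict adj g (λ _ → true)

sum-restrict-endpoints : ∀ {n} (g : Fin n → ℚ) {y z} → y ≢ z → sum (restrict (endpoint y z) g) ≡ g y + g z
sum-restrict-endpoints g {y} {z} y≢z = begin
  sum (restrict (endpoint y z) g)                       ≡⟨ sum-cong-≗ split ⟩
  sum (λ v → pointMass y (g y) v + pointMass z (g z) v) ≡⟨ ∑-distrib-+ (pointMass y (g y)) (pointMass z (g z)) ⟩
  sum (pointMass y (g y)) + sum (pointMass z (g z))     ≡⟨ cong₂ _+_ (sum-pointMass y (g y)) (sum-pointMass z (g z)) ⟩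
  g y + g z                                             ∎
  where
  open ≡-Reasoning
  split : ∀ v → restrict (endpoint y z) g v ≡ pointMass y (g y) v + pointMass z (g z) v
  split v with toSum (v Fin.≟ y) | toSum (v Fin.≟ z)
  ... | inj₁ refl | _ = begin
    restrict (endpoint y z) g y           ≡⟨ if-cong (endpoint-left y z) ⟩
    g y                                   ≡⟨ sym (ℚP.+-identityʳ (g y)) ⟩
    g y + 0ℚ                              ≡⟨ sym (cong₂ _+_ (pointMass-self y (g y)) (pointMass-other (g z) y≢z)) ⟩
    pointMass y (g y) y + pointMass z (g z) y ∎
  ... | inj₂ v≢y | inj₁ refl = begin
    restrict (endpoint y z) g z           ≡⟨ if-cong (endpoint-right y z) ⟩
    g z                                   ≡⟨ sym (ℚP.+-identityˡ (g z)) ⟩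
    0ℚ + g z                              ≡⟨ sym (cong₂ _+_ (pointMass-other (g y) v≢y) (pointMass-self z (g z))) ⟩
    pointMass y (g y) z + pointMass z (g z) z ∎
  ... | inj₂ v≢y | inj₂ v≢z = begin
    restrict (endpoint y z) g v           ≡⟨ if-cong (endpoint-false v≢y v≢z) ⟩
    0ℚ                                    ≡⟨ sym (cong₂ _+_ (pointMass-other (g y) v≢y) (pointMass-other (g z) v≢z)) ⟩
    pointMass y (g y) v + pointMass z (g z) v ∎

restrict-⊆-≤ : ∀ {n} {V U : Fin n → Bool} (g : Fin n → ℚ) → (∀ v → 0ℚ ℚ.≤ g v) →
  (∀ v → V v ≡ true → U v ≡ true) → ∀ v → restrict V g v ℚ.≤ restrict U g v
restrict-⊆-≤ {V = V} {U} g g≥0 V⊆U v with V v in Vv | U v in Uv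
... | true  | true  = ℚP.≤-refl
... | true  | false = contradiction (trans (sym (V⊆U v Vv)) Uv) λ ()
... | false | true  = g≥0 v
... | false | false = ℚP.≤-refl

sum-restrict-≤ : ∀ {n} (U : Fin n → Bool) (g : Fin n → ℚ) → (∀ v → 0ℚ ℚ.≤ g v) → sum (restrict U g) ℚ.≤ sum g
sum-restrict-≤ U g g≥0 = sum-mono-≤ (restrict-⊆-≤ {V = U} {U = λ _ → true} g g≥0 (λ _ _ → refl))

pair≤sum-restrict : ∀ {n} {U : Fin n → Bool} (g : Fin n → ℚ) → (∀ v → 0ℚ ℚ.≤ g v) →
  ∀ {a b} → a ≢ b → U a ≡ true → U b ≡ true → g a + g b ℚ.≤ sum (restrict U g)
pair≤sum-restrict {U = U} g g≥0 {a} {b} a≢b Ua Ub = begin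
  g a + g b                       ≡⟨ sum-restrict-endpoints g a≢b ⟨
  sum (restrict (endpoint a b) g) ≤⟨ sum-mono-≤ (restrict-⊆-≤ g g≥0 ⊆U) ⟩
  sum (restrict U g)              ∎
  where
  open ℚP.≤-Reasoning
  ⊆U : ∀ v → endpoint a b v ≡ true → U v ≡ true
  ⊆U v ab with endpoint⁻ {x = a} {y = b} {v = v} ab
  ... | inj₁ refl = Ua
  ... | inj₂ refl = Ub

sum-split : ∀ {n} (U : Fin n → Bool) (f : Fin n → ℚ) → sum f ≡ sum (restrict U f) + sum (restrict (not ∘ U) f)
sum-split U f = trans (sum-cong-≗ pieces) (∑-distrib-+ (restrict U f) (restrict (not ∘ U) f))
  where
  pieces : ∀ v → f v ≡ restrict U f v + restrict (not ∘ U) f v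
  pieces v with U v
  ... | true  = sym (ℚP.+-identityʳ (f v))
  ... | false = sym (ℚP.+-identityˡ (f v))

one-minus-≤ : ∀ {p q} → 1ℚ ℚ.≤ p + q → 1ℚ - p ℚ.≤ q
one-minus-≤ {p} {q} 1≤p+q = ℚP.≤-trans (ℚP.+-monoˡ-≤ (- p) 1≤p+q) (ℚP.≤-reflexive (cancel p q))
  where
  open QS.+-*-Solver
  cancel : ∀ p q → (p + q) - p ≡ q
  cancel = solve 2 (λ p q → (p :+ q) :- p := q) refl

module _ {n} (U : Fin n → Bool) (g : Fin n → ℚ)
         (pairs : ∀ y z → U y ≡ true → U z ≡ true → y ≢ z → 1ℚ ℚ.≤ g y + g z) where

  others-large : ∀ {v₀} → U v₀ ≡ true → g v₀ ℚ.≤ ½ →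
    ∀ v → U v ≡ true → v ≢ v₀ → ½ ℚ.≤ g v
  others-large {v₀} Uv₀ g₀≤½ v Uv v≢v₀ =
    ℚP.≤-trans (ℚP.+-monoʳ-≤ 1ℚ (ℚP.neg-antimono-≤ g₀≤½)) (one-minus-≤ {g v₀} (pairs v₀ v Uv₀ Uv (λ e → v≢v₀ (sym e))))

  half-mass-bound : ∀ {a b} → a ≢ b → U a ≡ true → U b ≡ true →
    sum (restrict U (λ _ → ½)) ℚ.≤ sum (restrict U g)
  half-mass-bound {a} {b} a≢b Ua Ub with any? (λ v → (U v Bool.≟ true) ×-dec (g v ℚ.<? ½))
  ... | no noSmall = sum-mono-≤ (λ v → restrict-mono-≤ U {g = g} (λ Uv → ℚP.≮⇒≥ (λ g<½ → noSmall (v , Uv , g<½))))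
  ... | yes (v₀ , Uv₀ , g₀<½) with another-member v₀
    where
    another-member : ∀ v₀ → Σ (Fin n) λ w → U w ≡ true × w ≢ v₀
    another-member v₀ with a Fin.≟ v₀
    ... | yes refl = b , Ub , λ b≡a → a≢b (sym b≡a)
    ... | no a≢v₀ = a , Ua , a≢v₀
  -- Moving the deficit g v₀ - ½ of v₀ onto another member w₀ gives a zero-sum shift
  -- with ½ + shift ≤ g on U.
  ... | w₀ , Uw₀ , w₀≢v₀ = begin
      sum ½U                     ≡⟨ sym (ℚP.+-identityʳ _) ⟩
      sum ½U + 0ℚ                ≡⟨ cong (λ s → sum ½U + s) (sym sum-shift) ⟩
      sum ½U + sum shift         ≡⟨ sym (∑-distrib-+ ½U shift) ⟩
      sum (λ v → ½U v + shift v) ≤⟨ sum-mono-≤ shifted≤g ⟩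
      sum (restrict U g)         ∎
    where
    open ℚP.≤-Reasoning
    open QS.+-*-Solver
    ½U = restrict U (λ _ → ½)
    d = g v₀ - ½
    shift : Fin n → ℚ
    shift v = pointMass v₀ d v + pointMass w₀ (- d) v
    sum-shift : sum shift ≡ 0ℚ
    sum-shift = trans (∑-distrib-+ (pointMass v₀ d) (pointMass w₀ (- d)))
                      (trans (cong₂ _+_ (sum-pointMass v₀ d) (sum-pointMass w₀ (- d))) (ℚP.+-inverseʳ d))
    shifted≤g : ∀ v → ½U v + shift v ℚ.≤ restrict U g v
    shifted≤g v with toSum (v Fin.≟ v₀) | toSum (v Fin.≟ w₀)
    ... | inj₁ refl | _ = ℚP.≤-reflexive (begin-equality
          ½U v₀ + shift v₀  ≡⟨ cong₂ _+_ (restrict-in U _ Uv₀) (cong₂ _+_ (pointMass-self v₀ d) (pointMass-other (- d) (λ e → w₀≢v₀ (sym e)))) ⟩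
          ½ + (d + 0ℚ)       ≡⟨ solve 1 (λ x → con ½ :+ ((x :- con ½) :+ con 0ℚ) := x) refl (g v₀) ⟩
          g v₀               ≡⟨ sym (restrict-in U g Uv₀) ⟩
          restrict U g v₀    ∎)
    ... | inj₂ v≢v₀ | inj₁ refl = begin
          ½U w₀ + shift w₀    ≡⟨ cong₂ _+_ (restrict-in U _ Uw₀) (cong₂ _+_ (pointMass-other d w₀≢v₀) (pointMass-self w₀ (- d))) ⟩
          ½ + (0ℚ + - d)      ≡⟨ solve 1 (λ x → con ½ :+ (con 0ℚ :+ (:- (x :- con ½))) := con 1ℚ :- x) refl (g v₀) ⟩
          1ℚ - g v₀           ≤⟨ one-minus-≤ {g v₀} (pairs v₀ w₀ Uv₀ Uw₀ (λ e → w₀≢v₀ (sym e))) ⟩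
          g w₀                ≡⟨ sym (restrict-in U g Uw₀) ⟩
          restrict U g w₀     ∎
    ... | inj₂ v≢v₀ | inj₂ v≢w₀ = begin
          ½U v + shift v      ≡⟨ cong (λ s → ½U v + s) (cong₂ _+_ (pointMass-other d v≢v₀) (pointMass-other (- d) v≢w₀)) ⟩
          ½U v + (0ℚ + 0ℚ)    ≡⟨ ℚP.+-identityʳ (½U v) ⟩
          ½U v                ≤⟨ restrict-mono-≤ U {g = g} (λ Uv → others-large Uv₀ (ℚP.<⇒≤ g₀<½) v Uv v≢v₀) ⟩
          restrict U g v      ∎

-- Distances

any-true : ∀ {n} (f : Fin n → Bool) {x} → f x ≡ true → any f (allFin n) ≡ true
any-true f {x} fx = Equivalence.to T-≡ (any⁺ f (Any.map (λ { refl → Equivalence.from T-≡ fx }) (∈-allFin x)))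

any-false : ∀ {A : Set} (f : A → Bool) (xs : List A) → (∀ x → f x ≡ false) → any f xs ≡ false
any-false f []       f≡false = refl
any-false f (x ∷ xs) f≡false rewrite f≡false x = any-false f xs f≡false

any-selects : ∀ {n} (u : Fin n) (f : Fin n → Bool) → any (λ w → ⌊ u Fin.≟ w ⌋ ∧ f w) (allFin n) ≡ f u
any-selects u f with f u in fu
... | true = any-true (λ w → ⌊ u Fin.≟ w ⌋ ∧ f w) (trans (cong (_∧ f u) (≟-self u)) fu)
... | false = any-false _ (allFin _) off
  where
  off : ∀ w → (⌊ u Fin.≟ w ⌋ ∧ f w) ≡ false
  off w with toSum (u Fin.≟ w)
  ... | inj₁ refl = trans (cong (_∧ f u) (≟-self u)) fu
  ... | inj₂ u≢w = cong (_∧ f w) (≟-distinct u≢w)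

module _ {n} (adj : Adj n) where

  reach-one : ∀ {u v} → u ≢ v → reach adj 1 u v ≡ adj u v
  reach-one {u} {v} u≢v = cong₂ _∨_ (≟-distinct u≢v) (any-selects u (λ w → adj w v))

  reach-one-adjacent : ∀ {u w} → adj u w ≡ true → reach adj 1 u w ≡ true
  reach-one-adjacent {u} {w} uw = trans (cong (reach adj 0 u w ∨_) (trans (any-selects u (λ x → adj x w)) uw)) (∨-zeroʳ _)

-- dist searches with fuel n, so a distance 2 is only found when n ≥ 3.
module _ {m} (adj : Adj (suc (suc (suc m)))) where

  dist-refl : ∀ u → dist adj u u ≡ 0
  dist-refl u = if-cong (≟-self u)

  dist-adjacent : ∀ {u v} → u ≢ v → adj u v ≡ true → dist adj u v ≡ 1
  dist-adjacent {u} {v} u≢v uv = trans (if-cong (≟-distinct u≢v)) (if-cong (trans (reach-one adj u≢v) uv))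

  dist-commonNeighbour : ∀ {u v w} → u ≢ v → adj u v ≡ false → adj u w ≡ true → adj w v ≡ true → dist adj u v ≡ 2
  dist-commonNeighbour {u} {v} {w} u≢v ¬uv uw wv =
    trans (if-cong (≟-distinct u≢v)) (trans (if-cong (trans (reach-one adj u≢v) ¬uv)) (if-cong reach-two))
    where
    reach-two : reach adj 2 u v ≡ true
    reach-two = trans (cong (_∨ any (λ x → reach adj 1 u x ∧ adj x v) (allFin _)) (trans (reach-one adj u≢v) ¬uv))
                      (any-true (λ x → reach adj 1 u x ∧ adj x v) (cong₂ _∧_ (reach-one-adjacent adj uw) wv))

-- Complete multipartite graphs

module Multipartite {m k : ℕ} (p : Fin (suc (suc (suc m))) → Fin (suc (suc k)))
                    (nonempty : AllPartsNonempty p) where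

  G : Adj (suc (suc (suc m)))
  G = multipartite p

  adjacent : ∀ {u v} → p u ≢ p v → G u v ≡ true
  adjacent pu≢pv = cong not (≟-distinct pu≢pv)

  nonadjacent : ∀ {u v} → p u ≡ p v → G u v ≡ false
  nonadjacent pu≡pv = cong not (≟-equal pu≡pv)

  adjacent⁻ : ∀ {u v} → G u v ≡ true → p u ≢ p v
  adjacent⁻ uv pu≡pv = contradiction (trans (sym uv) (nonadjacent pu≡pv)) λ ()

  adjacent⇒≢ : ∀ {u v} → G u v ≡ true → u ≢ v
  adjacent⇒≢ uv refl = adjacent⁻ uv refl

  adjacent-sym : ∀ {u v} → G u v ≡ true → G v u ≡ true
  adjacent-sym uv = adjacent (λ e → adjacent⁻ uv (sym e))

  neighbour-outside : ∀ {u v} t → t ≢ p u → t ≢ p v → ∃ λ w → G w u ≡ true × G w v ≡ true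
  neighbour-outside t t≢pu t≢pv with nonempty t
  ... | w , refl = w , adjacent t≢pu , adjacent t≢pv

  dist-otherPart : ∀ {u v} → p u ≢ p v → dist G u v ≡ 1
  dist-otherPart pu≢pv = dist-adjacent G (λ { refl → pu≢pv refl }) (adjacent pu≢pv)

  dist-samePart : ∀ {u v} → u ≢ v → p u ≡ p v → dist G u v ≡ 2
  dist-samePart {u} {v} u≢v pu≡pv with another (p u)
  ... | t , t≢pu with neighbour-outside t t≢pu (λ e → t≢pu (trans e (sym pu≡pv)))
  ...   | w , wu , wv = dist-commonNeighbour G u≢v (nonadjacent pu≡pv) (adjacent-sym wu) wv

  dist-positive : ∀ {u v} → u ≢ v → 1 ≤ dist G u v
  dist-positive {u} {v} u≢v with toSum (p u Fin.≟ p v)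
  ... | inj₁ pu≡pv = subst (1 ≤_) (sym (dist-samePart u≢v pu≡pv)) (s≤s z≤n)
  ... | inj₂ pu≢pv = subst (1 ≤_) (sym (dist-otherPart pu≢pv)) ℕP.≤-refl

  edgeDist-multipartite : ∀ {x y} → p x ≢ p y → ∀ v → edgeDist G x y v ≡ (if endpoint x y v then 0 else 1)
  edgeDist-multipartite {x} {y} px≢py v with toSum (v Fin.≟ x) | toSum (v Fin.≟ y)
  ... | inj₁ refl | _ =
    trans (cong (ℕ._⊓ dist G y x) (dist-refl G x)) (sym (if-cong (endpoint-left x y)))
  ... | inj₂ _ | inj₁ refl =
    trans (trans (cong (dist G x y ℕ.⊓_) (dist-refl G y)) (ℕP.⊓-zeroʳ (dist G x y))) (sym (if-cong (endpoint-right x y)))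
  ... | inj₂ v≢x | inj₂ v≢y = trans nearer-end (sym (if-cong (endpoint-false v≢x v≢y)))
    where
    nearer-end : dist G x v ℕ.⊓ dist G y v ≡ 1
    nearer-end with toSum (p x Fin.≟ p v)
    ... | inj₁ px≡pv = trans (ℕP.m≥n⇒m⊓n≡n (subst (ℕ._≤ dist G x v) (sym y-near) (dist-positive (λ e → v≢x (sym e))))) y-near
      where y-near = dist-otherPart (λ e → px≢py (trans px≡pv (sym e)))
    ... | inj₂ px≢pv = trans (ℕP.m≤n⇒m⊓n≡m (subst (ℕ._≤ dist G y v) (sym x-near) (dist-positive (λ e → v≢y (sym e))))) x-near
      where x-near = dist-otherPart px≢pv

  inR-symmetricDifference : ∀ {x₁ y₁ x₂ y₂} → G x₁ y₁ ≡ true → G x₂ y₂ ≡ true →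
    ∀ v → inR G x₁ y₁ x₂ y₂ v ≡ endpoint x₁ y₁ v xor endpoint x₂ y₂ v
  inR-symmetricDifference {x₁} {y₁} {x₂} {y₂} e₁ e₂ v =
    trans (cong₂ (λ s t → not ⌊ s ℕ.≟ t ⌋) (edgeDist-multipartite (adjacent⁻ e₁) v) (edgeDist-multipartite (adjacent⁻ e₂) v))
          (zero-one-distinct (endpoint x₁ y₁ v) (endpoint x₂ y₂ v))
    where
    zero-one-distinct : ∀ a b → not ⌊ (if a then 0 else 1) ℕ.≟ (if b then 0 else 1) ⌋ ≡ a xor b
    zero-one-distinct true  true  = refl
    zero-one-distinct true  false = refl
    zero-one-distinct false true  = refl
    zero-one-distinct false false = refl

  -- IsEdge only accepts the orientation toℕ x < toℕ y, so edges are handled through oriented copies.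
  Representative : Fin (suc (suc (suc m))) → Fin (suc (suc (suc m))) → Set
  Representative a b = ∃₂ λ x y → IsEdge G x y × (∀ v → endpoint x y v ≡ endpoint a b v)

  orient : ∀ {a b} → G a b ≡ true → Representative a b
  orient {a} {b} ab with ℕP.<-cmp (toℕ a) (toℕ b)
  ... | tri< a<b _ _ = a , b , (ab , a<b) , λ _ → refl
  ... | tri≈ _ a≡b _ = contradiction (toℕ-injective a≡b) (adjacent⇒≢ ab)
  ... | tri> _ _ b<a = b , a , (adjacent-sym ab , b<a) , endpoint-sym b a

  resolving⇒pair : ∀ {g} → IsEdgeResolving G g →
    ∀ {x y z} → G x y ≡ true → G x z ≡ true → y ≢ z → 1ℚ ℚ.≤ g y + g z
  resolving⇒pair {g} (_ , resolves) {x} {y} {z} xy xz y≢z = through (orient xy) (orient xz)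
    where
    z-separates : endpoint x y z ≢ endpoint x z z
    z-separates e = contradiction (trans (sym z-off) (trans e (endpoint-right x z))) λ ()
      where
      z-off : endpoint x y z ≡ false
      z-off = endpoint-false (λ z≡x → adjacent⇒≢ xz (sym z≡x)) (λ z≡y → y≢z (sym z≡y))
    -- A helper instead of a with-clause: with-abstraction would normalise the types mentioning
    -- inR, and the normal form of dist is huge.
    through : Representative x y → Representative x z → 1ℚ ℚ.≤ g y + g z
    through (x₁ , y₁ , E₁ , ends₁) (x₂ , y₂ , E₂ , ends₂) = begin
      1ℚ                                   ≤⟨ resolves x₁ y₁ x₂ y₂ E₁ E₂ distinct ⟩
      gSum G g (inR G x₁ y₁ x₂ y₂)         ≡⟨ gSum≡sum-restrict G g (inR G x₁ y₁ x₂ y₂) ⟩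
      sum (restrict (inR G x₁ y₁ x₂ y₂) g) ≡⟨ sum-cong-≗ (restrict-cong g R≡yz) ⟩
      sum (restrict (endpoint y z) g)      ≡⟨ sum-restrict-endpoints g y≢z ⟩
      g y + g z                            ∎
      where
      open ℚP.≤-Reasoning
      R≡yz : ∀ v → inR G x₁ y₁ x₂ y₂ v ≡ endpoint y z v
      R≡yz v = trans (inR-symmetricDifference (proj₁ E₁) (proj₁ E₂) v)
                     (trans (cong₂ _xor_ (ends₁ v) (ends₂ v))
                            (endpoint-xor-sharing (adjacent⇒≢ xy) (adjacent⇒≢ xz) y≢z v))
      distinct : ¬ (x₁ ≡ x₂ × y₁ ≡ y₂)
      distinct (refl , refl) = z-separates (trans (sym (ends₁ z)) (ends₂ z))

  resolving⇒pair-outside : ∀ {g} → IsEdgeResolving G g →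
    ∀ {y z} t → t ≢ p y → t ≢ p z → y ≢ z → 1ℚ ℚ.≤ g y + g z
  resolving⇒pair-outside g-resolving t t≢py t≢pz y≢z =
    let w , wy , wz = neighbour-outside t t≢py t≢pz in resolving⇒pair g-resolving wy wz y≢z

  resolvingSet-two : ∀ {x₁ y₁ x₂ y₂} → IsEdge G x₁ y₁ → IsEdge G x₂ y₂ → ¬ (x₁ ≡ x₂ × y₁ ≡ y₂) →
    ∃₂ λ a b → a ≢ b × inR G x₁ y₁ x₂ y₂ a ≡ true × inR G x₁ y₁ x₂ y₂ b ≡ true
  resolvingSet-two (e₁ , x₁<y₁) (e₂ , x₂<y₂) distinct =
    let a , b , a≢b , Δa , Δb = symmetricDifference-two x₁<y₁ x₂<y₂ distinct
    in a , b , a≢b , trans (inR-symmetricDifference e₁ e₂ a) Δa , trans (inR-symmetricDifference e₁ e₂ b) Δb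

  half-on-resolvingSets⇒resolving : ∀ {h} → (∀ v → 0ℚ ℚ.≤ h v × h v ℚ.≤ 1ℚ) →
    (∀ {x₁ y₁ x₂ y₂} → IsEdge G x₁ y₁ → IsEdge G x₂ y₂ → ∀ v → inR G x₁ y₁ x₂ y₂ v ≡ true → h v ≡ ½) →
    IsEdgeResolving G h
  half-on-resolvingSets⇒resolving {h} bounds half = bounds , resolves
    where
    resolves : ∀ x₁ y₁ x₂ y₂ → IsEdge G x₁ y₁ → IsEdge G x₂ y₂ → ¬ (x₁ ≡ x₂ × y₁ ≡ y₂) →
      1ℚ ℚ.≤ gSum G h (inR G x₁ y₁ x₂ y₂)
    resolves x₁ y₁ x₂ y₂ E₁ E₂ distinct = from-two (resolvingSet-two E₁ E₂ distinct)
      where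
      open ℚP.≤-Reasoning
      from-two : (∃₂ λ a b → a ≢ b × inR G x₁ y₁ x₂ y₂ a ≡ true × inR G x₁ y₁ x₂ y₂ b ≡ true) →
        1ℚ ℚ.≤ gSum G h (inR G x₁ y₁ x₂ y₂)
      from-two (a , b , a≢b , Ra , Rb) = begin
        1ℚ                                   ≡⟨ cong₂ _+_ (half E₁ E₂ a Ra) (half E₁ E₂ b Rb) ⟨
        h a + h b                            ≤⟨ pair≤sum-restrict {U = inR G x₁ y₁ x₂ y₂} h (proj₁ ∘ bounds) a≢b Ra Rb ⟩
        sum (restrict (inR G x₁ y₁ x₂ y₂) h) ≡⟨ gSum≡sum-restrict G h (inR G x₁ y₁ x₂ y₂) ⟨
        gSum G h (inR G x₁ y₁ x₂ y₂)         ∎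

  edimF-from-lowerBound : (∀ g → IsEdgeResolving G g → (+ suc (suc (suc m))) / 2 ℚ.≤ total G g) →
    EdimF≡ G ((+ suc (suc (suc m))) / 2)
  edimF-from-lowerBound lower =
    ((λ _ → ½) , half-on-resolvingSets⇒resolving (λ _ → 0≤½ , ½≤1) (λ _ _ _ _ → refl) , trans (total≡sum G (λ _ → ½)) (sum-const-½ (suc (suc (suc m))))) ,
    lower

  edimF-star : IsStar G → EdimF≡ G ((+ (suc (suc (suc m)) ∸ 1)) / 2)
  edimF-star (c , centre , spokes) = (h , h-resolving , h-total) , lower
    where
    leaf : Fin (suc (suc (suc m))) → Bool
    leaf v = not ⌊ v Fin.≟ c ⌋
    h : Fin (suc (suc (suc m))) → ℚ
    h = restrict leaf (λ _ → ½)
    leaf⇒≢ : ∀ {v} → leaf v ≡ true → v ≢ c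
    leaf⇒≢ = ≟-false⁻
    h-total : total G h ≡ (+ suc (suc m)) / 2
    h-total = begin
      total G h                             ≡⟨ total≡sum G h ⟩
      sum h                                 ≡⟨ sum-constExcept c h (λ v v≢c → if-cong (cong not (≟-distinct v≢c))) ⟩
      h c + sum {suc (suc m)} (λ _ → ½)     ≡⟨ cong₂ _+_ (if-cong (cong not (≟-self c))) (sum-const-½ (suc (suc m))) ⟩
      0ℚ + (+ suc (suc m)) / 2              ≡⟨ ℚP.+-identityˡ _ ⟩
      (+ suc (suc m)) / 2                   ∎
      where open ≡-Reasoning
    h-bounds : ∀ v → 0ℚ ℚ.≤ h v × h v ℚ.≤ 1ℚ
    h-bounds v with leaf v
    ... | true  = 0≤½ , ½≤1
    ... | false = ℚP.≤-refl , ℚP.≤-trans 0≤½ ½≤1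
    centre-endpoint : ∀ {x y} → G x y ≡ true → endpoint x y c ≡ true
    centre-endpoint {x} {y} xy = endpoint-true x y (Sum.map sym sym (proj₁ (centre _ _ xy)))
    h-resolving : IsEdgeResolving G h
    h-resolving = half-on-resolvingSets⇒resolving h-bounds half
      where
      half : ∀ {x₁ y₁ x₂ y₂} → IsEdge G x₁ y₁ → IsEdge G x₂ y₂ → ∀ v → inR G x₁ y₁ x₂ y₂ v ≡ true → h v ≡ ½
      half (e₁ , _) (e₂ , _) v Rv = if-cong (cong not (≟-distinct v≢c))
        where
        v≢c : v ≢ c
        v≢c refl = contradiction
          (trans (sym Rv) (trans (inR-symmetricDifference e₁ e₂ c) (cong₂ _xor_ (centre-endpoint e₁) (centre-endpoint e₂))))
          λ ()
    lower : ∀ g → IsEdgeResolving G g → (+ suc (suc m)) / 2 ℚ.≤ total G g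
    lower g g-resolving =
      let a , b , a≢b , a≢c , b≢c = two-others c
      in begin
      (+ suc (suc m)) / 2  ≡⟨ h-total ⟨
      total G h            ≡⟨ total≡sum G h ⟩
      sum h                ≤⟨ half-mass-bound leaf g pairs a≢b (cong not (≟-distinct a≢c)) (cong not (≟-distinct b≢c)) ⟩
      sum (restrict leaf g) ≤⟨ sum-restrict-≤ leaf g (λ v → proj₁ (proj₁ g-resolving v)) ⟩
      sum g                ≡⟨ total≡sum G g ⟨
      total G g            ∎
      where
      open ℚP.≤-Reasoning
      pairs : ∀ y z → leaf y ≡ true → leaf z ≡ true → y ≢ z → 1ℚ ℚ.≤ g y + g z
      pairs y z ly lz y≢z = resolving⇒pair g-resolving
        (spokes c y (λ e → leaf⇒≢ ly (sym e)) (inj₁ refl)) (spokes c z (λ e → leaf⇒≢ lz (sym e)) (inj₁ refl)) y≢z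

module ThreeOrMoreParts {m k : ℕ} (p : Fin (suc (suc (suc m))) → Fin (suc (suc (suc k))))
                        (nonempty : AllPartsNonempty p) where
  open Multipartite p nonempty

  lowerBound : ∀ g → IsEdgeResolving G g → (+ suc (suc (suc m))) / 2 ℚ.≤ total G g
  lowerBound g g-resolving = begin
    (+ suc (suc (suc m))) / 2 ≡⟨ sum-const-½ (suc (suc (suc m))) ⟨
    sum {suc (suc (suc m))} (λ _ → ½) ≤⟨ half-mass-bound (λ _ → true) g pairs {zero} {suc zero} (λ ()) refl refl ⟩
    sum g                    ≡⟨ total≡sum G g ⟨
    total G g                ∎
    where
    open ℚP.≤-Reasoning
    pairs : ∀ y z → true ≡ true → true ≡ true → y ≢ z → 1ℚ ℚ.≤ g y + g z
    pairs y z _ _ y≢z =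
      let t , t≢py , t≢pz = avoiding-two (p y) (p z) in resolving⇒pair-outside g-resolving t t≢py t≢pz y≢z

module TwoParts {m : ℕ} (p : Fin (suc (suc (suc m))) → Fin 2) (nonempty : AllPartsNonempty p) where
  open Multipartite p nonempty

  two-in-each-part : ¬ IsStar G → ∀ i → ∃₂ λ a b → a ≢ b × p a ≡ i × p b ≡ i
  two-in-each-part ¬star i with nonempty i
  ... | v , pv with any? (λ w → (p w Fin.≟ i) ×-dec ¬? (w Fin.≟ v))
  ...   | yes (w , pw , w≢v) = w , v , w≢v , pw , pv
  ...   | no  noOther = contradiction (v , centre , spokes) ¬star
    where
    -- A part with a single vertex v makes v the centre of a star.
    alone : ∀ {u} → p u ≡ i → u ≡ v
    alone {u} pu = decidable-stable (u Fin.≟ v) (λ u≢v → noOther (u , pu , u≢v))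
    centre : ∀ u w → G u w ≡ true → (u ≡ v ⊎ w ≡ v) × u ≢ w
    centre u w uw = Sum.map alone alone (Fin2-≢⇒one-≡ i (adjacent⁻ uw)) , adjacent⇒≢ uw
    spokes : ∀ u w → u ≢ w → u ≡ v ⊎ w ≡ v → G u w ≡ true
    spokes u w u≢w (inj₁ refl) = adjacent (λ pu≡pw → u≢w (sym (alone (trans (sym pu≡pw) pv))))
    spokes u w u≢w (inj₂ refl) = adjacent (λ pu≡pw → u≢w (alone (trans pu≡pw pv)))

  lowerBound : ¬ IsStar G → ∀ g → IsEdgeResolving G g → (+ suc (suc (suc m))) / 2 ℚ.≤ total G g
  lowerBound ¬star g g-resolving = begin
    (+ suc (suc (suc m))) / 2                                         ≡⟨ sum-const-½ (suc (suc (suc m))) ⟨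
    sum {suc (suc (suc m))} (λ _ → ½)                               ≡⟨ sum-split part₀ (λ _ → ½) ⟩
    sum (restrict part₀ (λ _ → ½)) + sum (restrict part₁ (λ _ → ½)) ≤⟨ ℚP.+-mono-≤ bound₀ bound₁ ⟩
    sum (restrict part₀ g) + sum (restrict part₁ g)                  ≡⟨ sum-split part₀ g ⟨
    sum g                                                            ≡⟨ total≡sum G g ⟨
    total G g                                                        ∎
    where
    open ℚP.≤-Reasoning
    part₀ part₁ : Fin (suc (suc (suc m))) → Bool
    part₀ v = ⌊ p v Fin.≟ zero ⌋
    part₁ = not ∘ part₀

    bound : ∀ U t → (∀ {v} → U v ≡ true → p v ≢ t) → (∃₂ λ a b → a ≢ b × U a ≡ true × U b ≡ true) →
      sum (restrict U (λ _ → ½)) ℚ.≤ sum (restrict U g)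
    bound U t avoids (a , b , a≢b , Ua , Ub) = half-mass-bound U g pairs a≢b Ua Ub
      where
      pairs : ∀ y z → U y ≡ true → U z ≡ true → y ≢ z → 1ℚ ℚ.≤ g y + g z
      pairs y z Uy Uz y≢z = resolving⇒pair-outside g-resolving t (λ e → avoids Uy (sym e)) (λ e → avoids Uz (sym e)) y≢z

    bound₀ : sum (restrict part₀ (λ _ → ½)) ℚ.≤ sum (restrict part₀ g)
    bound₀ =
      let a , b , a≢b , pa , pb = two-in-each-part ¬star zero in
      bound part₀ (suc zero) (λ p₀ p₁ → contradiction (trans (sym (≟-true⁻ p₀)) p₁) λ ()) (a , b , a≢b , ≟-equal pa , ≟-equal pb)

    bound₁ : sum (restrict part₁ (λ _ → ½)) ℚ.≤ sum (restrict part₁ g)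
    bound₁ =
      let a , b , a≢b , pa , pb = two-in-each-part ¬star (suc zero) in
      bound part₁ zero ≟-false⁻ (a , b , a≢b , in₁ pa , in₁ pb)
      where
      in₁ : ∀ {v} → p v ≡ suc zero → part₁ v ≡ true
      in₁ pv = cong not (≟-distinct (λ p₀ → contradiction (trans (sym pv) p₀) λ ()))

mainTheorem14 : (k n : ℕ) → 2 ≤ k → 3 ≤ n → (p : Fin n → Fin k) → AllPartsNonempty p →
    (IsStar (multipartite p) → EdimF≡ (multipartite p) ((+ (n ∸ 1)) / 2)) ×
    (¬ IsStar (multipartite p) → EdimF≡ (multipartite p) ((+ n) / 2))
mainTheorem14 (suc (suc zero)) (suc (suc (suc m))) (s≤s (s≤s z≤n)) (s≤s (s≤s (s≤s z≤n))) p nonempty =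
  edimF-star , λ ¬star → edimF-from-lowerBound (TwoParts.lowerBound p nonempty ¬star)
  where open Multipartite p nonempty
mainTheorem14 (suc (suc (suc k))) (suc (suc (suc m))) (s≤s (s≤s z≤n)) (s≤s (s≤s (s≤s z≤n))) p nonempty =
  edimF-star , λ _ → edimF-from-lowerBound (ThreeOrMoreParts.lowerBound p nonempty)
  where open Multipartite p nonempty
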